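{- Let $(m,n)$ be a coprime pair of positive integers. Then the number of $(m,n)$-Dyck paths $D$ with $\bar D=D$ equals $$\binom{\lfloor m/2\rfloor+\lfloor n/2\rfloor}{\lfloor m/2\rfloor}.$$
   Context: A path is a word in the letters $N$ (unit step $(0,1)$) and $E$ (unit step $(1,0)$) starting at $(0,0)$. An $(m,n)$-Dyck path is a path from $(0,0)$ to $(m,n)$ that never goes below the line $y=\frac nm x$. The rank of a lattice point $(a,b)$ is $r(a,b)=mb-na$; for coprime $m,n$ the lattice points of a Dyck path $D$ other than its endpoint have distinct ranks. For a path $Q$, $Q^{rev}$ is the path whose word is that of $Q$ read backwards. Rank complement: write $D=Q_1Q_2$, where $Q_1$ consists of the steps of $D$ up to the (unique) lattice point of $D$ of maximal rank; then $\bar D=Q_1^{rev}Q_2^{rev}$ (concatenation of words), again an $(m,n)$-Dyck path. -}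

module Defs where

open import Data.Bool using (Bool; true; false; if_then_else_)
open import Data.Nat using (ℕ; zero; suc; _+_; _*_; _≤_)
open import Data.Integer as ℤ using (ℤ; +_; _-_; _≤ᵇ_)
open import Data.List using (List; []; _∷_; length; take; drop; reverse; _++_; map; upTo)
open import Data.Product using (_×_; _,_)
open import Relation.Binary.PropositionalEquality using (_≡_)

data Step : Set where
  N E : Step

Path : Set
Path = List Step

endpoint : Path → ℕ × ℕ
endpoint [] = 0 , 0
endpoint (N ∷ p) with endpoint p
... | a , b = a , suc b
endpoint (E ∷ p) with endpoint p
... | a , b = suc a , b

-- the k-th lattice point of the path (k = 0 … length p)
point : Path → ℕ → ℕ × ℕ
point p k = endpoint (take k p)

-- (m,n)-Dyck path: from (0,0) to (m,n), never below y = (n/m) x,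
-- i.e. every lattice point (a,b) satisfies n*a ≤ m*b
IsDyck : ℕ → ℕ → Path → Set
IsDyck m n D =
  endpoint D ≡ (m , n) ×
  (∀ k → k ≤ length D → let (a , b) = point D k in n * a ≤ m * b)

rank : ℕ → ℕ → ℕ × ℕ → ℤ
rank m n (a , b) = + (m * b) - + (n * a)

-- index of the first maximum of a list of integers
-- go i bestVal bestIdx rest
argmaxGo : ℕ → ℤ → ℕ → List ℤ → ℕ
argmaxGo i bv bi [] = bi
argmaxGo i bv bi (y ∷ ys) =
  if y ≤ᵇ bv then argmaxGo (suc i) bv bi ys else argmaxGo (suc i) y i ys

argmax : List ℤ → ℕ
argmax [] = 0
argmax (x ∷ xs) = argmaxGo 1 x 0 xs

maxRankIndex : ℕ → ℕ → Path → ℕ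
maxRankIndex m n D = argmax (map (λ k → rank m n (point D k)) (upTo (suc (length D))))

-- rank complement: D = Q₁ Q₂ with Q₁ the steps up to the max-rank point;
-- D̄ = Q₁^rev Q₂^rev
rankComplement : ℕ → ℕ → Path → Path
rankComplement m n D =
  reverse (take (maxRankIndex m n D) D) ++ reverse (drop (maxRankIndex m n D) D)

-- Rank.  r(p) = m·y − n·x at the endpoint (x,y) of p is additive, so a Dyck
-- path is a path to (m,n) all of whose prefixes have rank ≥ 0.  Coprimality
-- makes every proper non-empty factor of a path to (m,n) have non-zero rank
-- (DistinctRanks).  Hence a word to (m,n) has exactly one Dyck conjugate
-- (cyclic lemma), and in a Dyck path Q₁Q₂ with palindromic factors the end of
-- Q₁ is the unique point of maximal rank.  So D̄ = D iff D is a Dyck path that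
-- factors into two palindromes.
--
-- A palindrome is h c hʳ with a centre |c| ≤ 1.  The parities of
-- (m,n) force the two centres of a fixed path to be a fixed pair {α, β}
-- (CenterPair), and products of two such palindromes are exactly the
-- conjugates of the words α u β uʳ (TwoPalindromes).
--
-- Therefore u ↦ (the Dyck conjugate of α u β uʳ) is a bijection from
-- the paths to (⌊m/2⌋, ⌊n/2⌋) onto the fixed points (FixedPoints); those paths
-- are counted by the binomial coefficient (pathsTo).
module Submission where

open import Defs
import Data.Nat as ℕ
open import Data.Nat using (ℕ; NonZero; zero; suc; _<_; _≤_; _+_; _*_; _∸_; _/_; _%_; z≤n; s≤s)
import Data.Nat.Properties as ℕP
open import Data.Nat.Properties
  using (+-comm; +-identityʳ; +-suc; +-cancelˡ-≡; suc-injective; *-comm; *-zeroʳ; *-identityʳ; *-distribˡ-+;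
         *-cancelˡ-≡; *-cancelʳ-≡; m+n≡0⇒m≡0; m+n≡0⇒n≡0; m+n∸n≡m; m≤m+n; m≤n+m; m≤n⇒m⊓n≡m; m⊓n≤m;
         ≤-antisym; ≤-trans)
open import Data.Nat.Coprimality using (Coprime; coprime-divisor)
open import Data.Nat.Divisibility using (divides; m%n≡0⇒n∣m)
open import Data.Nat.Combinatorics using (_C_; nCn≡1; nCk+nC[k+1]≡[n+1]C[k+1])
open import Data.Nat.DivMod using (m≡m%n+[m/n]*n; [m+kn]%n≡m%n; m<n⇒m%n≡m; m%n<n)
import Data.Nat.Tactic.RingSolver as ℕ-Solver
open import Data.List using (List; []; _∷_; length; take; drop; reverse; _++_; map; upTo; applyUpTo)
open import Data.List.Properties
  using (∷-injective; ∷-injectiveʳ; ++-conicalˡ; ++-conicalʳ; ++-identityʳ; ++-assoc; ++-monoid;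
         unfold-reverse; reverse-++; reverse-involutive; length-++; length-++-≤ˡ; length-map; length-reverse;
         length-take; length-drop; take++drop≡id; drop-drop; map-applyUpTo)
open import Data.List.Membership.Propositional using (_∈_)
open import Data.List.Membership.Propositional.Properties using (∈-map⁺; ∈-map⁻; ∈-++⁺ˡ; ∈-++⁺ʳ; ∈-++⁻)
open import Data.List.Relation.Unary.Any using (here; there)
import Data.List.Relation.Unary.All as All
open import Data.List.Relation.Unary.AllPairs using ([]; _∷_)
open import Data.List.Relation.Unary.Unique.Propositional using (Unique)
import Data.List.Relation.Unary.Unique.Propositional.Properties as Unique
open import Data.Product using (Σ; _×_; _,_; proj₁; proj₂)
open import Data.Sum using (_⊎_; inj₁; inj₂)
open import Relation.Nullary using (yes; no)
open import Data.Bool using (true; false; T)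
open import Data.Unit using (tt)
open import Data.Empty using (⊥; ⊥-elim)
open import Function using (_∘_)
open import Tactic.MonoidSolver using (solve)
open import Data.Integer as Int using (ℤ; 0ℤ)
import Data.Integer.Properties as ℤP
open Int using (-_) renaming (_+_ to _+ℤ_; _-_ to _-ℤ_; _≤_ to _≤ℤ_; _<_ to _<ℤ_)
import Data.Integer.Tactic.RingSolver as ℤ-Solver
open import Function.Bundles using (_⇔_; mk⇔; Equivalence)
open import Relation.Binary.PropositionalEquality

bit-plus-double-injective : ∀ {i j} x y → i < 2 → j < 2 → i + x * 2 ≡ j + y * 2 → i ≡ j × x ≡ y
bit-plus-double-injective {i} {j} x y i<2 j<2 e =
  i≡j , *-cancelʳ-≡ x y 2 (+-cancelˡ-≡ i (x * 2) (y * 2) (trans e (cong (_+ y * 2) (sym i≡j))))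
  where
    open ≡-Reasoning
    i≡j : i ≡ j
    i≡j = begin
      i                ≡⟨ sym (m<n⇒m%n≡m i<2) ⟩
      i % 2            ≡⟨ sym ([m+kn]%n≡m%n i x 2) ⟩
      (i + x * 2) % 2  ≡⟨ cong (_% 2) e ⟩
      (j + y * 2) % 2  ≡⟨ [m+kn]%n≡m%n j y 2 ⟩
      j % 2            ≡⟨ m<n⇒m%n≡m j<2 ⟩
      j                ∎

outer-summands-zero : ∀ {x y z} → x + (y + z) ≡ y → x ≡ 0 × z ≡ 0
outer-summands-zero {x} {y} {z} eq = m+n≡0⇒m≡0 x x+z≡0 , m+n≡0⇒n≡0 x x+z≡0
  where
    shuffle : ∀ x y z → y + (x + z) ≡ x + (y + z)
    shuffle = ℕ-Solver.solve-∀
    x+z≡0 : x + z ≡ 0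
    x+z≡0 = +-cancelˡ-≡ y (x + z) 0 (trans (shuffle x y z) (trans eq (sym (+-identityʳ y))))

module _ where
  open ℤ-Solver

  ≤-+-cancel : ∀ a b → a ≤ℤ a +ℤ b → 0ℤ ≤ℤ b
  ≤-+-cancel a b le = subst₂ _≤ℤ_ (ℤP.+-inverseˡ a) (cancel a b) (ℤP.+-monoʳ-≤ (- a) le)
    where
      cancel : ∀ a b → - a +ℤ (a +ℤ b) ≡ b
      cancel = solve-∀

  +-cancel-≡ : ∀ a b → a +ℤ b ≡ a → b ≡ 0ℤ
  +-cancel-≡ a b e = trans (split a b) (trans (cong (_-ℤ a) e) (ℤP.+-inverseʳ a))
    where
      split : ∀ a b → b ≡ (a +ℤ b) -ℤ a
      split = solve-∀

  ≤-+-nonneg : ∀ a b → 0ℤ ≤ℤ b → a ≤ℤ a +ℤ b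
  ≤-+-nonneg a b nonneg = subst (_≤ℤ a +ℤ b) (ℤP.+-identityʳ a) (ℤP.+-monoʳ-≤ a nonneg)

  +-zero-≤ : ∀ a b c → a +ℤ b ≡ 0ℤ → a ≤ℤ c → 0ℤ ≤ℤ b +ℤ c
  +-zero-≤ a b c sum le = subst₂ _≤ℤ_ (trans (ℤP.+-comm b a) sum) refl (ℤP.+-monoʳ-≤ b le)

  drop-bound : ∀ a b c → a +ℤ (b +ℤ c) ≡ 0ℤ → 0ℤ ≤ℤ a +ℤ c → a +ℤ b ≤ℤ a
  drop-bound a b c sum nonneg =
    subst₂ _≤ℤ_ (sym (trans (split a b c) (cong (_-ℤ c) sum))) (sym (unsplit a c))
                (ℤP.+-monoˡ-≤ (- c) nonneg)
    where
      split : ∀ a b c → a +ℤ b ≡ (a +ℤ (b +ℤ c)) -ℤ c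
      split = solve-∀
      unsplit : ∀ a c → a ≡ (a +ℤ c) -ℤ c
      unsplit = solve-∀

module _ {A : Set} where

  ++-equidivisible : ∀ (a b c d : List A) → a ++ b ≡ c ++ d →
    (Σ (List A) λ x → c ≡ a ++ x × b ≡ x ++ d) ⊎ (Σ (List A) λ x → a ≡ c ++ x × d ≡ x ++ b)
  ++-equidivisible [] b c d e = inj₁ (c , refl , e)
  ++-equidivisible (s ∷ a) b [] d e = inj₂ (s ∷ a , refl , sym e)
  ++-equidivisible (s ∷ a) b (t ∷ c) d e with ∷-injective e
  ... | refl , e′ with ++-equidivisible a b c d e′
  ...   | inj₁ (x , refl , b≡) = inj₁ (x , refl , b≡)
  ...   | inj₂ (x , refl , d≡) = inj₂ (x , refl , d≡)

  ++-cancel-at-length : ∀ (a b c d : List A) → a ++ b ≡ c ++ d → length a ≡ length c →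
                        a ≡ c × b ≡ d
  ++-cancel-at-length [] b [] d e _ = refl , e
  ++-cancel-at-length (s ∷ a) b (t ∷ c) d e l with ∷-injective e
  ... | refl , e′ with ++-cancel-at-length a b c d e′ (suc-injective l)
  ...   | refl , b≡d = refl , b≡d

  take-length-++ : ∀ (a b : List A) → take (length a) (a ++ b) ≡ a
  take-length-++ [] b = refl
  take-length-++ (s ∷ a) b = cong (s ∷_) (take-length-++ a b)

  drop-length-++ : ∀ (a b : List A) → drop (length a) (a ++ b) ≡ b
  drop-length-++ [] b = refl
  drop-length-++ (s ∷ a) b = drop-length-++ a b

  Palindrome : List A → Set
  Palindrome q = reverse q ≡ q

  reverse-factors-palindromes : ∀ (a b : List A) → reverse a ++ reverse b ≡ a ++ b →
                                Palindrome a × Palindrome b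
  reverse-factors-palindromes a b e =
    ++-cancel-at-length (reverse a) (reverse b) a b e (length-reverse a)

  palindrome-factors : ∀ {q} (x y : List A) → Palindrome q → q ≡ x ++ y → q ≡ reverse y ++ reverse x
  palindrome-factors x y pal q≡ = trans (sym pal) (trans (cong reverse q≡) (reverse-++ x y))

  reverse-reverse-++ : ∀ (x y : List A) → reverse (reverse x ++ y) ≡ reverse y ++ x
  reverse-reverse-++ x y = trans (reverse-++ (reverse x) y) (cong (reverse y ++_) (reverse-involutive x))

  reverse-reverse-factors : ∀ {u} (x y : List A) → reverse u ≡ x ++ y → u ≡ reverse y ++ reverse x
  reverse-reverse-factors {u} x y e =
    trans (sym (reverse-involutive u)) (trans (cong reverse e) (reverse-++ x y))

  -- Palindromes of even or odd length are pal h c with a centre c of length ≤ 1.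
  data Center : List A → Set where
    none : Center []
    single : ∀ s → Center (s ∷ [])

  pal : List A → List A → List A
  pal h c = h ++ c ++ reverse h

  center-length : ∀ {c} → Center c → length c ≤ 1
  center-length none = z≤n
  center-length (single _) = s≤s z≤n

  short-center : ∀ c → length c ≤ 1 → Center c
  short-center [] _ = none
  short-center (s ∷ []) _ = single s
  short-center (_ ∷ _ ∷ _) (s≤s ())

  center-split : ∀ {c} → Center c → ∀ x y → c ≡ x ++ y → x ≡ [] ⊎ y ≡ []
  center-split none x y e = inj₁ (++-conicalˡ x y (sym e))
  center-split (single s) [] y e = inj₁ refl
  center-split (single s) (t ∷ x) y e = inj₂ (++-conicalʳ x y (sym (proj₂ (∷-injective e))))

  pal-palindrome : ∀ h {c} → Center c → Palindrome (pal h c)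
  pal-palindrome h {c} cc = begin
    reverse (h ++ c ++ reverse h)            ≡⟨ reverse-++ h (c ++ reverse h) ⟩
    reverse (c ++ reverse h) ++ reverse h    ≡⟨ cong (_++ reverse h) (reverse-++ c (reverse h)) ⟩
    (reverse (reverse h) ++ reverse c) ++ reverse h
      ≡⟨ cong₂ (λ u v → (u ++ v) ++ reverse h) (reverse-involutive h) (center-palindrome cc) ⟩
    (h ++ c) ++ reverse h                    ≡⟨ ++-assoc h c (reverse h) ⟩
    h ++ c ++ reverse h                      ∎
    where
      open ≡-Reasoning
      center-palindrome : ∀ {c} → Center c → Palindrome c
      center-palindrome none = refl
      center-palindrome (single _) = refl

  -- |h c hʳ| = |c| + 2|h|, so |c| is the parity of the length.
  length-pal : ∀ h c → length (pal h c) ≡ length c + length h * 2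
  length-pal h c = begin
    length (h ++ c ++ reverse h)                  ≡⟨ length-++ h ⟩
    length h + length (c ++ reverse h)            ≡⟨ cong (length h +_) (length-++ c) ⟩
    length h + (length c + length (reverse h))
      ≡⟨ cong (λ z → length h + (length c + z)) (length-reverse h) ⟩
    length h + (length c + length h)              ≡⟨ shuffle (length h) (length c) ⟩
    length c + length h * 2                       ∎
    where
      open ≡-Reasoning
      shuffle : ∀ x y → x + (y + x) ≡ y + x * 2
      shuffle = ℕ-Solver.solve-∀

  -- Every palindrome q is pal h c for a centre c: h is the prefix of length ⌊|q|/2⌋.
  palindrome-center : ∀ (q : List A) → Palindrome q →
                      Σ (List A) λ h → Σ (List A) λ c → Center c × q ≡ pal h c
  palindrome-center q pal-q = h , c , short-center c |c|≤1 , q≡hct′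
    where
      open ≡-Reasoning
      k e : ℕ
      k = length q / 2
      e = length q % 2
      h c t : List A
      h = take k q
      c = take e (drop k q)
      t = drop e (drop k q)
      q≡hct : q ≡ h ++ c ++ t
      q≡hct = sym (trans (cong (h ++_) (take++drop≡id e (drop k q))) (take++drop≡id k q))
      |q| : length q ≡ k + (k + e)
      |q| = trans (m≡m%n+[m/n]*n (length q) 2) (shuffle e k)
        where shuffle : ∀ e k → e + k * 2 ≡ k + (k + e)
              shuffle = ℕ-Solver.solve-∀
      |t| : length (reverse t) ≡ length h
      |t| = begin
        length (reverse t)             ≡⟨ length-reverse t ⟩
        length t                       ≡⟨ cong length (drop-drop k e q) ⟩
        length (drop (k + e) q)        ≡⟨ length-drop (k + e) q ⟩
        length q ∸ (k + e)             ≡⟨ cong (_∸ (k + e)) |q| ⟩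
        k + (k + e) ∸ (k + e)          ≡⟨ m+n∸n≡m k (k + e) ⟩
        k                              ≡⟨ sym (m≤n⇒m⊓n≡m (subst (k ≤_) (sym |q|) (m≤m+n k (k + e)))) ⟩
        k ℕ.⊓ length q                 ≡⟨ sym (length-take k q) ⟩
        length h                       ∎
      -- reading q backwards, reverse t is the prefix of length |h|, hence t = reverse h
      t≡rh : t ≡ reverse h
      t≡rh = trans (sym (reverse-involutive t))
                   (cong reverse (proj₁ (++-cancel-at-length (reverse t) _ h _ backwards |t|)))
        where
          backwards : reverse t ++ reverse c ++ reverse h ≡ h ++ c ++ t
          backwards = begin
            reverse t ++ reverse c ++ reverse h   ≡⟨ sym (++-assoc (reverse t) (reverse c) (reverse h)) ⟩
            (reverse t ++ reverse c) ++ reverse h ≡⟨ cong (_++ reverse h) (sym (reverse-++ c t)) ⟩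
            reverse (c ++ t) ++ reverse h         ≡⟨ sym (reverse-++ h (c ++ t)) ⟩
            reverse (h ++ c ++ t)                 ≡⟨ cong reverse (sym q≡hct) ⟩
            reverse q                             ≡⟨ trans pal-q q≡hct ⟩
            h ++ c ++ t                           ∎
      q≡hct′ : q ≡ pal h c
      q≡hct′ = trans q≡hct (cong (λ z → h ++ c ++ z) t≡rh)
      |c|≤1 : length c ≤ 1
      |c|≤1 = subst (_≤ 1) (sym (length-take e (drop k q)))
                    (≤-trans (m⊓n≤m e _) (ℕP.≤-pred (m%n<n (length q) 2)))

  -- The half word and the centre of a palindrome are unique: the length fixes
  -- |c| and |h|, and then the factors themselves.
  pal-injective : ∀ (h h′ : List A) {c c′} → Center c → Center c′ → pal h c ≡ pal h′ c′ → h ≡ h′ × c ≡ c′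
  pal-injective h h′ {c} {c′} cc cc′ e
    with bit-plus-double-injective (length h) (length h′) (s≤s (center-length cc)) (s≤s (center-length cc′))
           (trans (sym (length-pal h c)) (trans (cong length e) (length-pal h′ c′)))
  ... | |c|≡|c′| , |h|≡|h′| with ++-cancel-at-length h _ h′ _ e |h|≡|h′|
  ...   | refl , rest = refl , proj₁ (++-cancel-at-length c _ c′ _ rest |c|≡|c′|)

_⊕_ : ℕ × ℕ → ℕ × ℕ → ℕ × ℕ
u ⊕ v = proj₁ u + proj₁ v , proj₂ u + proj₂ v

twice : ℕ × ℕ → ℕ × ℕ
twice v = proj₁ v * 2 , proj₂ v * 2

⊕-twice-cancel : ∀ v x y → v ⊕ twice x ≡ v ⊕ twice y → x ≡ y
⊕-twice-cancel v x y e = cong₂ _,_ (halve (proj₁ v) (cong proj₁ e)) (halve (proj₂ v) (cong proj₂ e))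
  where
    halve : ∀ {a b} c → c + a * 2 ≡ c + b * 2 → a ≡ b
    halve {a} {b} c eq = *-cancelʳ-≡ a b 2 (+-cancelˡ-≡ c (a * 2) (b * 2) eq)

parity : ℕ × ℕ → ℕ × ℕ
parity v = proj₁ v % 2 , proj₂ v % 2

parity-⊕-twice : ∀ v x → parity (v ⊕ twice x) ≡ parity v
parity-⊕-twice v x = cong₂ _,_ ([m+kn]%n≡m%n (proj₁ v) (proj₁ x) 2) ([m+kn]%n≡m%n (proj₂ v) (proj₂ x) 2)

endpoint-++ : ∀ p q → endpoint (p ++ q) ≡ endpoint p ⊕ endpoint q
endpoint-++ [] q = refl
endpoint-++ (N ∷ p) q = cong (λ e → proj₁ e , suc (proj₂ e)) (endpoint-++ p q)
endpoint-++ (E ∷ p) q = cong (λ e → suc (proj₁ e) , proj₂ e) (endpoint-++ p q)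

endpoint-conjugate : ∀ p q → endpoint (q ++ p) ≡ endpoint (p ++ q)
endpoint-conjugate p q = begin
  endpoint (q ++ p)              ≡⟨ endpoint-++ q p ⟩
  endpoint q ⊕ endpoint p
    ≡⟨ cong₂ _,_ (+-comm (proj₁ (endpoint q)) _) (+-comm (proj₂ (endpoint q)) _) ⟩
  endpoint p ⊕ endpoint q        ≡⟨ endpoint-++ p q ⟨
  endpoint (p ++ q)              ∎
  where open ≡-Reasoning

endpoint-reverse : ∀ p → endpoint (reverse p) ≡ endpoint p
endpoint-reverse [] = refl
endpoint-reverse (s ∷ p) = begin
  endpoint (reverse (s ∷ p))               ≡⟨ cong endpoint (unfold-reverse s p) ⟩
  endpoint (reverse p ++ s ∷ [])           ≡⟨ endpoint-++ (reverse p) (s ∷ []) ⟩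
  endpoint (reverse p) ⊕ endpoint (s ∷ []) ≡⟨ cong (_⊕ endpoint (s ∷ [])) (endpoint-reverse p) ⟩
  endpoint p ⊕ endpoint (s ∷ [])           ≡⟨ endpoint-++ p (s ∷ []) ⟨
  endpoint (p ++ s ∷ [])                   ≡⟨ endpoint-conjugate (s ∷ []) p ⟩
  endpoint (s ∷ p)                         ∎
  where open ≡-Reasoning

endpoint-zero : ∀ p → endpoint p ≡ (0 , 0) → p ≡ []
endpoint-zero [] _ = refl
endpoint-zero (N ∷ p) ()
endpoint-zero (E ∷ p) ()

-- The word c₁ u c₂ uʳ, whose conjugates are the products of two palindromes
-- with centres c₁, c₂ (see TwoPalindromes).
cyclic : Path → Path → Path → Path
cyclic c₁ c₂ u = c₁ ++ u ++ c₂ ++ reverse u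

endpoint-cyclic : ∀ c₁ c₂ u →
                  endpoint (cyclic c₁ c₂ u) ≡ (endpoint c₁ ⊕ endpoint c₂) ⊕ twice (endpoint u)
endpoint-cyclic c₁ c₂ u = begin
  endpoint (c₁ ++ u ++ c₂ ++ reverse u)
    ≡⟨ endpoint-++ c₁ _ ⟩
  endpoint c₁ ⊕ endpoint (u ++ c₂ ++ reverse u)
    ≡⟨ cong (endpoint c₁ ⊕_) (endpoint-++ u _) ⟩
  endpoint c₁ ⊕ (endpoint u ⊕ endpoint (c₂ ++ reverse u))
    ≡⟨ cong (λ z → endpoint c₁ ⊕ (endpoint u ⊕ z))
            (trans (endpoint-++ c₂ _) (cong (endpoint c₂ ⊕_) (endpoint-reverse u))) ⟩
  endpoint c₁ ⊕ (endpoint u ⊕ (endpoint c₂ ⊕ endpoint u))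
    ≡⟨ cong₂ _,_ (shuffle (proj₁ (endpoint c₁)) (proj₁ (endpoint c₂)) (proj₁ (endpoint u)))
                 (shuffle (proj₂ (endpoint c₁)) (proj₂ (endpoint c₂)) (proj₂ (endpoint u))) ⟩
  (endpoint c₁ ⊕ endpoint c₂) ⊕ twice (endpoint u) ∎
  where
    open ≡-Reasoning
    shuffle : ∀ x y z → x + (z + (y + z)) ≡ (x + y) + z * 2
    shuffle = ℕ-Solver.solve-∀

module _ where
  open Int using (_≤ᵇ_)

  ≤ᵇ-true : ∀ {x y} → x ≤ℤ y → (x ≤ᵇ y) ≡ true
  ≤ᵇ-true {x} {y} le with x ≤ᵇ y | ℤP.≤⇒≤ᵇ le
  ... | true | _ = refl

  ≤ᵇ-false : ∀ {x y} → y <ℤ x → (x ≤ᵇ y) ≡ false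
  ≤ᵇ-false {x} {y} lt with x ≤ᵇ y in eq
  ... | false = refl
  ... | true = ⊥-elim (ℤP.<⇒≱ lt (ℤP.≤ᵇ⇒≤ (subst T (sym eq) tt)))

  argmaxGo-keep : ∀ c (g : ℕ → ℤ) i bv bi → (∀ j → j < c → g j ≤ℤ bv) →
                  argmaxGo i bv bi (applyUpTo g c) ≡ bi
  argmaxGo-keep zero g i bv bi below = refl
  argmaxGo-keep (suc c) g i bv bi below rewrite ≤ᵇ-true (below 0 (s≤s z≤n)) =
    argmaxGo-keep c (g ∘ suc) (suc i) bv bi (λ j j<c → below (suc j) (s≤s j<c))

  argmaxGo-find : ∀ c (g : ℕ → ℤ) i bv bi t → t < c → bv <ℤ g t → (∀ j → j < c → j ≢ t → g j <ℤ g t) →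
                  argmaxGo i bv bi (applyUpTo g c) ≡ i + t
  argmaxGo-find (suc c) g i bv bi zero _ bv<gt others rewrite ≤ᵇ-false bv<gt =
    trans (argmaxGo-keep c (g ∘ suc) (suc i) (g 0) i (λ j j<c → ℤP.<⇒≤ (others (suc j) (s≤s j<c) λ ())))
          (sym (+-identityʳ i))
  argmaxGo-find (suc c) g i bv bi (suc t) (s≤s t<c) bv<gt others with g 0 ℤP.≤? bv
  ... | yes g0≤bv rewrite ≤ᵇ-true g0≤bv =
    trans (argmaxGo-find c (g ∘ suc) (suc i) bv bi t t<c bv<gt later) (sym (+-suc i t))
    where
      later : ∀ j → j < c → j ≢ t → g (suc j) <ℤ g (suc t)
      later j j<c j≢t = others (suc j) (s≤s j<c) (j≢t ∘ suc-injective)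
  ... | no g0≰bv rewrite ≤ᵇ-false (ℤP.≰⇒> g0≰bv) =
    trans (argmaxGo-find c (g ∘ suc) (suc i) (g 0) i t t<c (others 0 (s≤s z≤n) λ ()) later) (sym (+-suc i t))
    where
      later : ∀ j → j < c → j ≢ t → g (suc j) <ℤ g (suc t)
      later j j<c j≢t = others (suc j) (s≤s j<c) (j≢t ∘ suc-injective)

  argmax-strict : ∀ L (H : ℕ → ℤ) k → k ≤ L → (∀ j → j ≤ L → j ≢ k → H j <ℤ H k) →
                  argmax (map H (upTo (suc L))) ≡ k
  argmax-strict L H zero _ strict rewrite map-applyUpTo suc H L =
    argmaxGo-keep L (H ∘ suc) 1 (H 0) 0 (λ j j<L → ℤP.<⇒≤ (strict (suc j) j<L λ ()))
  argmax-strict L H (suc t) t<L strict rewrite map-applyUpTo suc H L =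
    argmaxGo-find L (H ∘ suc) 1 (H 0) 0 t t<L (strict 0 z≤n λ ())
                  (λ j j<L j≢t → strict (suc j) j<L (j≢t ∘ suc-injective))

module Rank (m n : ℕ) where
  open Int using (+_)

  r : Path → ℤ
  r p = rank m n (endpoint p)

  r-++ : ∀ p q → r (p ++ q) ≡ r p +ℤ r q
  r-++ p q = trans (cong (rank m n) (endpoint-++ p q)) (rank-⊕ (endpoint p) (endpoint q))
    where
      open ≡-Reasoning
      interchange : ∀ x y z w → (x +ℤ y) -ℤ (z +ℤ w) ≡ (x -ℤ z) +ℤ (y -ℤ w)
      interchange = ℤ-Solver.solve-∀
      rank-⊕ : ∀ u v → rank m n (u ⊕ v) ≡ rank m n u +ℤ rank m n v
      rank-⊕ (a , b) (c , d) = begin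
        + (m ℕ.* (b ℕ.+ d)) -ℤ + (n ℕ.* (a ℕ.+ c))
          ≡⟨ cong₂ (λ x y → + x -ℤ + y) (*-distribˡ-+ m b d) (*-distribˡ-+ n a c) ⟩
        + (m ℕ.* b ℕ.+ m ℕ.* d) -ℤ + (n ℕ.* a ℕ.+ n ℕ.* c)
          ≡⟨ cong₂ _-ℤ_ (ℤP.pos-+ (m ℕ.* b) (m ℕ.* d)) (ℤP.pos-+ (n ℕ.* a) (n ℕ.* c)) ⟩
        (+ (m ℕ.* b) +ℤ + (m ℕ.* d)) -ℤ (+ (n ℕ.* a) +ℤ + (n ℕ.* c))
          ≡⟨ interchange (+ (m ℕ.* b)) (+ (m ℕ.* d)) (+ (n ℕ.* a)) (+ (n ℕ.* c)) ⟩
        (+ (m ℕ.* b) -ℤ + (n ℕ.* a)) +ℤ (+ (m ℕ.* d) -ℤ + (n ℕ.* c)) ∎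

  r-reverse : ∀ p → r (reverse p) ≡ r p
  r-reverse p = cong (rank m n) (endpoint-reverse p)

  r-[] : r [] ≡ 0ℤ
  r-[] = cong₂ (λ x y → + x -ℤ + y) (*-zeroʳ m) (*-zeroʳ n)

  r-N : r (N ∷ []) ≡ + m
  r-N = trans (cong₂ (λ x y → + x -ℤ + y) (*-identityʳ m) (*-zeroʳ n)) (ℤP.+-identityʳ (+ m))

  r-E : r (E ∷ []) ≡ - + n
  r-E = trans (cong₂ (λ x y → + x -ℤ + y) (*-zeroʳ m) (*-identityʳ n)) (ℤP.+-identityˡ (- + n))

  r-closed : ∀ D → endpoint D ≡ (m , n) → r D ≡ 0ℤ
  r-closed D e =
    trans (cong (rank m n) e) (trans (cong (λ x → + x -ℤ + (n ℕ.* m)) (*-comm m n)) (ℤP.+-inverseʳ (+ (n ℕ.* m))))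

  Dyck : Path → Set
  Dyck D = endpoint D ≡ (m , n) × (∀ A B → D ≡ A ++ B → 0ℤ ≤ℤ r A)

  -- This is the Dyck condition of Defs: point k of D is the endpoint of take k D.
  isDyck⇔Dyck : ∀ D → IsDyck m n D ⇔ Dyck D
  isDyck⇔Dyck D = mk⇔ to from
    where
      nonneg : ∀ v → n ℕ.* proj₁ v ℕ.≤ m ℕ.* proj₂ v → 0ℤ ≤ℤ rank m n v
      nonneg v le = ℤP.i≤j⇒0≤j-i (Int.+≤+ le)
      nonneg⁻ : ∀ v → 0ℤ ≤ℤ rank m n v → n ℕ.* proj₁ v ℕ.≤ m ℕ.* proj₂ v
      nonneg⁻ v le = ℤP.drop‿+≤+ (ℤP.0≤i-j⇒j≤i le)
      to : IsDyck m n D → Dyck D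
      to (e , below) = e , λ A B D≡ →
        subst (λ p → 0ℤ ≤ℤ r p) (trans (cong (take (length A)) D≡) (take-length-++ A B))
          (nonneg _ (below (length A) (subst (λ p → length A ℕ.≤ length p) (sym D≡) (length-++-≤ˡ A))))
      from : Dyck D → IsDyck m n D
      from (e , prefixes) =
        e , λ k _ → nonneg⁻ _ (prefixes (take k D) (drop k D) (sym (take++drop≡id k D)))

  extend : ∀ s {A A′} → r A ≤ℤ r A′ → r (s ∷ A) ≤ℤ r (s ∷ A′)
  extend s {A} {A′} le =
    subst₂ _≤ℤ_ (sym (r-++ (s ∷ []) A)) (sym (r-++ (s ∷ []) A′)) (ℤP.+-monoʳ-≤ (r (s ∷ [])) le)

  record MinimalSplit (w : Path) : Set where
    constructor minimalSplit
    field
      prefix suffix : Path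
      split : w ≡ prefix ++ suffix
      minimal : ∀ A B → w ≡ A ++ B → r prefix ≤ℤ r A

  -- Every word has a prefix of minimal rank: either [] or one step more than
  -- the minimal prefix of the tail.
  minimal-split : ∀ w → MinimalSplit w
  minimal-split [] = minimalSplit [] [] refl λ A B e → ℤP.≤-reflexive (cong r (sym (++-conicalˡ A B (sym e))))
  minimal-split (s ∷ w) with minimal-split w
  ... | minimalSplit A B w≡ min with r (s ∷ A) ℤP.≤? 0ℤ
  ...   | yes neg = minimalSplit (s ∷ A) B (cong (s ∷_) w≡) below
    where
      below : ∀ A′ B′ → s ∷ w ≡ A′ ++ B′ → r (s ∷ A) ≤ℤ r A′
      below [] B′ _ = subst (r (s ∷ A) ≤ℤ_) (sym r-[]) neg
      below (t ∷ A′) B′ e with ∷-injective e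
      ... | refl , w≡′ = extend t (min A′ B′ w≡′)
  ...   | no pos = minimalSplit [] (s ∷ w) refl above
    where
      above : ∀ A′ B′ → s ∷ w ≡ A′ ++ B′ → r [] ≤ℤ r A′
      above [] B′ _ = ℤP.≤-refl
      above (t ∷ A′) B′ e with ∷-injective e
      ... | refl , w≡′ =
        subst (_≤ℤ r (s ∷ A′)) (sym r-[]) (ℤP.≤-trans (ℤP.<⇒≤ (ℤP.≰⇒> pos)) (extend s (min A′ B′ w≡′)))

  rotate-to-minimum : Path → Path
  rotate-to-minimum w = suffix ++ prefix
    where open MinimalSplit (minimal-split w)

  -- A prefix of B A is B x with x a prefix of A, of rank
  -- r B + r x ≥ r B + r A = 0, or a prefix A′ of B, of rank r(A A′) − r A ≥ 0.
  cyclic-lemma : ∀ w → endpoint w ≡ (m , n) → Dyck (rotate-to-minimum w)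
  cyclic-lemma w e = trans (endpoint-conjugate A B) (trans (cong endpoint (sym w≡)) e) , prefixes
    where
      open MinimalSplit (minimal-split w) renaming (prefix to A; suffix to B; split to w≡; minimal to min)
      rA+rB : r A +ℤ r B ≡ 0ℤ
      rA+rB = trans (sym (r-++ A B)) (trans (cong r (sym w≡)) (r-closed w e))
      prefixes : ∀ A′ B′ → B ++ A ≡ A′ ++ B′ → 0ℤ ≤ℤ r A′
      prefixes A′ B′ eq with ++-equidivisible B A A′ B′ eq
      ... | inj₁ (x , refl , A≡) =
        subst (0ℤ ≤ℤ_) (sym (r-++ B x)) (+-zero-≤ (r A) (r B) (r x) rA+rB (min x (B′ ++ B) w≡xB′B))
        where
          w≡xB′B : w ≡ x ++ B′ ++ B
          w≡xB′B = trans w≡ (trans (cong (_++ B) A≡) (++-assoc x B′ B))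
      ... | inj₂ (x , B≡ , refl) =
        ≤-+-cancel (r A) (r A′) (subst (r A ≤ℤ_) (r-++ A A′) (min (A ++ A′) x w≡AA′x))
        where
          w≡AA′x : w ≡ (A ++ A′) ++ x
          w≡AA′x = trans w≡ (trans (cong (A ++_) B≡) (sym (++-assoc A A′ x)))

  -- If A = Q₁ x, then Q₂ = x B = Bʳ xʳ and Q₁ Bʳ is a prefix,
  -- so r x = −(r Q₁ + r B) ≤ 0; if Q₁ = A x = xʳ Aʳ, the prefix xʳ gives r x ≥ 0.
  palindromic-max : ∀ {Q₁ Q₂} → Dyck (Q₁ ++ Q₂) → Palindrome Q₁ → Palindrome Q₂ →
                    ∀ A B → Q₁ ++ Q₂ ≡ A ++ B → r A ≤ℤ r Q₁
  palindromic-max {Q₁} {Q₂} (e , prefixes) pal₁ pal₂ A B eq with ++-equidivisible Q₁ Q₂ A B eq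
  ... | inj₁ (x , refl , Q₂≡) =
        subst (_≤ℤ r Q₁) (sym (r-++ Q₁ x)) (drop-bound (r Q₁) (r x) (r B) total mirrored)
    where
      total : r Q₁ +ℤ (r x +ℤ r B) ≡ 0ℤ
      total = trans (cong (r Q₁ +ℤ_) (trans (sym (r-++ x B)) (cong r (sym Q₂≡))))
                (trans (sym (r-++ Q₁ Q₂)) (r-closed (Q₁ ++ Q₂) e))
      mirrored : 0ℤ ≤ℤ r Q₁ +ℤ r B
      mirrored = subst (0ℤ ≤ℤ_) (trans (r-++ Q₁ (reverse B)) (cong (r Q₁ +ℤ_) (r-reverse B)))
                   (prefixes (Q₁ ++ reverse B) (reverse x)
                     (trans (cong (Q₁ ++_) (palindrome-factors x B pal₂ Q₂≡))
                            (sym (++-assoc Q₁ (reverse B) (reverse x)))))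
  ... | inj₂ (x , Q₁≡ , refl) =
        subst (r A ≤ℤ_) (trans (sym (r-++ A x)) (cong r (sym Q₁≡))) (≤-+-nonneg (r A) (r x) mirrored)
    where
      mirrored : 0ℤ ≤ℤ r x
      mirrored = subst (0ℤ ≤ℤ_) (r-reverse x)
                   (prefixes (reverse x) (reverse A ++ Q₂)
                     (trans (cong (_++ Q₂) (palindrome-factors A x pal₁ Q₁≡))
                            (++-assoc (reverse x) (reverse A) Q₂)))

  fixed⇒palindromic : ∀ D → rankComplement m n D ≡ D →
                      Palindrome (take (maxRankIndex m n D) D) × Palindrome (drop (maxRankIndex m n D) D)
  fixed⇒palindromic D fixed =
    reverse-factors-palindromes (take k D) (drop k D) (trans fixed (sym (take++drop≡id k D)))
    where
      k : ℕ
      k = maxRankIndex m n D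

module DistinctRanks (m n : ℕ) (m>0 : 0 < m) (n>0 : 0 < n) (cop : Coprime m n) where
  open Rank m n
  instance
    m≢0 : NonZero m
    m≢0 = ℕ.>-nonZero m>0

  diagonal-points : ∀ x y → m * y ≡ n * x → x ≤ m → (x ≡ 0 × y ≡ 0) ⊎ (x ≡ m × y ≡ n)
  diagonal-points x y on-line x≤m with coprime-divisor cop (divides y (trans (sym on-line) (*-comm m y)))
  ... | divides zero x≡0 =
        inj₁ (x≡0 , *-cancelˡ-≡ y 0 m (trans on-line (trans (cong (n *_) x≡0) (trans (*-zeroʳ n) (sym (*-zeroʳ m))))))
  ... | divides (suc q) x≡ =
        inj₂ (x≡m , *-cancelˡ-≡ y n m (trans on-line (trans (cong (n *_) x≡m) (*-comm n m))))
    where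
      x≡m : x ≡ m
      x≡m = ≤-antisym x≤m (subst (m ≤_) (sym x≡) (m≤m+n m (q * m)))

  rank-zero-factor : ∀ A M Z → endpoint (A ++ M ++ Z) ≡ (m , n) → r M ≡ 0ℤ → M ≡ [] ⊎ (A ≡ [] × Z ≡ [])
  rank-zero-factor A M Z e rM≡0 = from-diagonal (diagonal-points x y on-line x≤m)
    where
      x y : ℕ
      x = proj₁ (endpoint M)
      y = proj₂ (endpoint M)
      parts : endpoint A ⊕ (endpoint M ⊕ endpoint Z) ≡ (m , n)
      parts = trans (sym (trans (endpoint-++ A (M ++ Z)) (cong (endpoint A ⊕_) (endpoint-++ M Z)))) e
      on-line : m * y ≡ n * x
      on-line = ℤP.+-injective (trans (split (Int.+ (m * y)) (Int.+ (n * x)))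
                                      (trans (cong (_+ℤ Int.+ (n * x)) rM≡0) (ℤP.+-identityˡ _)))
        where
          split : ∀ i j → i ≡ (i -ℤ j) +ℤ j
          split = ℤ-Solver.solve-∀
      x≤m : x ≤ m
      x≤m = subst (x ≤_) (cong proj₁ parts) (≤-trans (m≤m+n x _) (m≤n+m _ (proj₁ (endpoint A))))
      from-diagonal : (x ≡ 0 × y ≡ 0) ⊎ (x ≡ m × y ≡ n) → M ≡ [] ⊎ (A ≡ [] × Z ≡ [])
      from-diagonal (inj₁ (x≡0 , y≡0)) = inj₁ (endpoint-zero M (cong₂ _,_ x≡0 y≡0))
      from-diagonal (inj₂ (x≡m , y≡n)) =
        inj₂ (endpoint-zero A (cong₂ _,_ (proj₁ xs) (proj₁ ys)) , endpoint-zero Z (cong₂ _,_ (proj₂ xs) (proj₂ ys)))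
        where
          xs : proj₁ (endpoint A) ≡ 0 × proj₁ (endpoint Z) ≡ 0
          xs = outer-summands-zero (trans (cong proj₁ parts) (sym x≡m))
          ys : proj₂ (endpoint A) ≡ 0 × proj₂ (endpoint Z) ≡ 0
          ys = outer-summands-zero (trans (cong proj₂ parts) (sym y≡n))

  -- Two conjugate Dyck paths coincide: both halves have rank ≥ 0 and sum 0.
  conjugate-dyck : ∀ X Y → Dyck (X ++ Y) → Dyck (Y ++ X) → X ++ Y ≡ Y ++ X
  conjugate-dyck X Y (e , prefixes) (_ , prefixes′) with rank-zero-factor [] X Y e rX≡0
    where
      rX≡0 : r X ≡ 0ℤ
      rX≡0 = ℤP.≤-antisym
        (subst (r X ≤ℤ_) (trans (sym (r-++ X Y)) (r-closed (X ++ Y) e)) (≤-+-nonneg (r X) (r Y) (prefixes′ Y X refl)))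
        (prefixes X Y refl)
  ... | inj₁ refl = sym (++-identityʳ Y)
  ... | inj₂ (_ , refl) = ++-identityʳ X

  dyck-conjugates-unique : ∀ A B A′ B′ → A ++ B ≡ A′ ++ B′ → Dyck (B ++ A) → Dyck (B′ ++ A′) →
                           B ++ A ≡ B′ ++ A′
  dyck-conjugates-unique A B A′ B′ eq d d′ with ++-equidivisible A B A′ B′ eq
  ... | inj₁ (x , refl , refl) =
        trans (++-assoc x B′ A)
          (trans (conjugate-dyck x (B′ ++ A) (subst Dyck (++-assoc x B′ A) d) (subst Dyck (sym (++-assoc B′ A x)) d′))
                 (++-assoc B′ A x))
  ... | inj₂ (x , refl , refl) =
        sym (trans (++-assoc x B A′)
          (trans (conjugate-dyck x (B ++ A′) (subst Dyck (++-assoc x B A′) d′) (subst Dyck (sym (++-assoc B A′ x)) d))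
                 (++-assoc B A′ x)))

  dyck-positive-prefix : ∀ {D} → Dyck D → Σ Path λ A → Σ Path λ B → D ≡ A ++ B × 0ℤ <ℤ r A
  dyck-positive-prefix {[]} (e , _) = ⊥-elim (ℕP.<⇒≢ m>0 (cong proj₁ e))
  dyck-positive-prefix {E ∷ D} (_ , prefixes) =
    ⊥-elim (ℤP.<⇒≱ (ℤP.neg-mono-< (Int.+<+ n>0)) (subst (0ℤ ≤ℤ_) r-E (prefixes (E ∷ []) D refl)))
  dyck-positive-prefix {N ∷ D} _ = N ∷ [] , D , refl , subst (0ℤ <ℤ_) (sym r-N) (Int.+<+ m>0)

  palindromic-first-positive : ∀ {Q₁ Q₂} → Dyck (Q₁ ++ Q₂) → Palindrome Q₁ → Palindrome Q₂ → 0ℤ <ℤ r Q₁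
  palindromic-first-positive d pal₁ pal₂ with dyck-positive-prefix d
  ... | A , B , eq , rA>0 = ℤP.<-≤-trans rA>0 (palindromic-max d pal₁ pal₂ A B eq)

  palindromic-max-unique : ∀ {Q₁ Q₂} → Dyck (Q₁ ++ Q₂) → Palindrome Q₁ → Palindrome Q₂ →
                           ∀ A B → Q₁ ++ Q₂ ≡ A ++ B → r A ≡ r Q₁ → A ≡ Q₁
  palindromic-max-unique {Q₁} {Q₂} d@(e , _) pal₁ pal₂ A B eq rA≡ = from-overlap (++-equidivisible Q₁ Q₂ A B eq)
    where
      -- the overlap x of A and Q₁ has rank 0, so it is empty, since the empty
      -- prefix has rank 0 < r Q₁
      not-empty : r [] ≡ r Q₁ → ⊥
      not-empty r[]≡ = ℤP.<⇒≢ (palindromic-first-positive d pal₁ pal₂) (trans (sym r-[]) r[]≡)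
      from-overlap : (Σ Path λ x → A ≡ Q₁ ++ x × Q₂ ≡ x ++ B) ⊎ (Σ Path λ x → Q₁ ≡ A ++ x × B ≡ x ++ Q₂) →
                     A ≡ Q₁
      from-overlap (inj₁ (x , refl , Q₂≡))
        with rank-zero-factor Q₁ x B (subst (λ q → endpoint (Q₁ ++ q) ≡ (m , n)) Q₂≡ e)
                              (+-cancel-≡ (r Q₁) (r x) (trans (sym (r-++ Q₁ x)) rA≡))
      ... | inj₁ refl = ++-identityʳ Q₁
      ... | inj₂ (Q₁≡[] , _) = ⊥-elim (not-empty (cong r (sym Q₁≡[])))
      from-overlap (inj₂ (x , Q₁≡ , refl))
        with rank-zero-factor A x Q₂
               (subst (λ q → endpoint q ≡ (m , n)) (trans (cong (_++ Q₂) Q₁≡) (++-assoc A x Q₂)) e)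
               (+-cancel-≡ (r A) (r x) (trans (sym (r-++ A x)) (trans (cong r (sym Q₁≡)) (sym rA≡))))
      ... | inj₁ refl = sym (trans Q₁≡ (++-identityʳ A))
      ... | inj₂ (A≡[] , _) = ⊥-elim (not-empty (trans (cong r (sym A≡[])) rA≡))

  maxRankIndex-palindromic : ∀ {Q₁ Q₂} → Dyck (Q₁ ++ Q₂) → Palindrome Q₁ → Palindrome Q₂ →
                             maxRankIndex m n (Q₁ ++ Q₂) ≡ length Q₁
  maxRankIndex-palindromic {Q₁} {Q₂} d pal₁ pal₂ =
    argmax-strict (length (Q₁ ++ Q₂)) (λ k → r (take k (Q₁ ++ Q₂))) (length Q₁) (length-++-≤ˡ Q₁) strict
    where
      strict : ∀ j → j ≤ length (Q₁ ++ Q₂) → j ≢ length Q₁ →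
               r (take j (Q₁ ++ Q₂)) <ℤ r (take (length Q₁) (Q₁ ++ Q₂))
      strict j j≤ j≢ = subst (r prefix <ℤ_) (cong r (sym (take-length-++ Q₁ Q₂)))
        (ℤP.≤∧≢⇒< (palindromic-max d pal₁ pal₂ prefix suffix split)
                  (λ eq → j≢ (trans (sym |prefix|)
                                    (cong length (palindromic-max-unique d pal₁ pal₂ prefix suffix split eq)))))
        where
          prefix suffix : Path
          prefix = take j (Q₁ ++ Q₂)
          suffix = drop j (Q₁ ++ Q₂)
          split : Q₁ ++ Q₂ ≡ prefix ++ suffix
          split = sym (take++drop≡id j (Q₁ ++ Q₂))
          |prefix| : length prefix ≡ j
          |prefix| = trans (length-take j (Q₁ ++ Q₂)) (m≤n⇒m⊓n≡m j≤)

  palindromic-factorisation-unique : ∀ {D} Q₁ Q₂ Q₁′ Q₂′ → Dyck D → D ≡ Q₁ ++ Q₂ → D ≡ Q₁′ ++ Q₂′ →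
                                     Palindrome Q₁ → Palindrome Q₂ → Palindrome Q₁′ → Palindrome Q₂′ →
                                     Q₁ ≡ Q₁′ × Q₂ ≡ Q₂′
  palindromic-factorisation-unique Q₁ Q₂ Q₁′ Q₂′ d refl D≡′ pal₁ pal₂ pal₁′ pal₂′ =
    ++-cancel-at-length Q₁ Q₂ Q₁′ Q₂′ D≡′
      (trans (sym (maxRankIndex-palindromic d pal₁ pal₂))
             (trans (cong (maxRankIndex m n) D≡′) (maxRankIndex-palindromic (subst Dyck D≡′ d) pal₁′ pal₂′)))

  centred-factorisation-unique : ∀ {D} h₁ h₂ h₁′ h₂′ {c₁ c₂ c₁′ c₂′} →
    Center c₁ → Center c₂ → Center c₁′ → Center c₂′ → Dyck D →
    D ≡ pal h₁ c₁ ++ pal h₂ c₂ → D ≡ pal h₁′ c₁′ ++ pal h₂′ c₂′ →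
    (h₁ ≡ h₁′ × c₁ ≡ c₁′) × (h₂ ≡ h₂′ × c₂ ≡ c₂′)
  centred-factorisation-unique h₁ h₂ h₁′ h₂′ cc₁ cc₂ cc₁′ cc₂′ d D≡ D≡′
    with palindromic-factorisation-unique _ _ _ _ d D≡ D≡′
           (pal-palindrome h₁ cc₁) (pal-palindrome h₂ cc₂) (pal-palindrome h₁′ cc₁′) (pal-palindrome h₂′ cc₂′)
  ... | first , second = pal-injective h₁ h₁′ cc₁ cc₁′ first , pal-injective h₂ h₂′ cc₂ cc₂′ second

  palindromic⇒fixed : ∀ {Q₁ Q₂} → Dyck (Q₁ ++ Q₂) → Palindrome Q₁ → Palindrome Q₂ →
                      rankComplement m n (Q₁ ++ Q₂) ≡ Q₁ ++ Q₂
  palindromic⇒fixed {Q₁} {Q₂} d pal₁ pal₂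
    rewrite maxRankIndex-palindromic d pal₁ pal₂ | take-length-++ Q₁ Q₂ | drop-length-++ Q₁ Q₂ =
    cong₂ _++_ pal₁ pal₂

module TwoPalindromes (c₁ c₂ : Path) where

  HasShape : Path → Path → Set
  HasShape u D = Σ Path λ h₁ → Σ Path λ h₂ → u ≡ reverse h₁ ++ h₂ ×
                   (D ≡ pal h₁ c₁ ++ pal h₂ c₂ ⊎ D ≡ pal h₂ c₂ ++ pal h₁ c₁)

  shape-conjugate : ∀ {u D} → HasShape u D →
                    Σ Path λ A → Σ Path λ B → cyclic c₁ c₂ u ≡ A ++ B × D ≡ B ++ A
  shape-conjugate (h₁ , h₂ , refl , inj₁ refl) rewrite reverse-reverse-++ h₁ h₂ =
    c₁ ++ reverse h₁ ++ h₂ ++ c₂ ++ reverse h₂ , h₁ , solve (++-monoid Step) , solve (++-monoid Step)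
  shape-conjugate (h₁ , h₂ , refl , inj₂ refl) rewrite reverse-reverse-++ h₁ h₂ =
    c₁ ++ reverse h₁ , h₂ ++ c₂ ++ reverse h₂ ++ h₁ , solve (++-monoid Step) , solve (++-monoid Step)

  shape-palindromic : Center c₁ → Center c₂ → ∀ {u D} → HasShape u D →
                      Σ Path λ Q₁ → Σ Path λ Q₂ → D ≡ Q₁ ++ Q₂ × Palindrome Q₁ × Palindrome Q₂
  shape-palindromic cc₁ cc₂ (h₁ , h₂ , _ , inj₁ D≡) =
    pal h₁ c₁ , pal h₂ c₂ , D≡ , pal-palindrome h₁ cc₁ , pal-palindrome h₂ cc₂
  shape-palindromic cc₁ cc₂ (h₁ , h₂ , _ , inj₂ D≡) =
    pal h₂ c₂ , pal h₁ c₁ , D≡ , pal-palindrome h₂ cc₂ , pal-palindrome h₁ cc₁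

  private
    cut-in-u : ∀ x y → (y ++ c₂ ++ reverse (x ++ y)) ++ c₁ ++ x ≡ pal y c₂ ++ pal (reverse x) c₁
    cut-in-u x y rewrite reverse-++ x y | reverse-involutive x = solve (++-monoid Step)

    cut-in-reverse-u : ∀ z B → B ++ c₁ ++ (reverse B ++ reverse z) ++ c₂ ++ z ≡
                               pal B c₁ ++ pal (reverse z) c₂
    cut-in-reverse-u z B rewrite reverse-involutive z = solve (++-monoid Step)

    cut-before-c₂ : ∀ u → (c₂ ++ reverse u) ++ c₁ ++ u ++ [] ≡ pal [] c₂ ++ pal (reverse u) c₁
    cut-before-c₂ u rewrite reverse-involutive u = solve (++-monoid Step)

    cut-after-c₂ : ∀ u → reverse u ++ c₁ ++ u ++ c₂ ≡ pal (reverse u) c₁ ++ pal [] c₂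
    cut-after-c₂ u rewrite reverse-involutive u = solve (++-monoid Step)

    u≡reverse-reverse-u : ∀ (u : Path) → u ≡ reverse (reverse u) ++ []
    u≡reverse-reverse-u u = sym (trans (++-identityʳ (reverse (reverse u))) (reverse-involutive u))

  -- Every conjugate of cyclic c₁ c₂ u has shape u: cut the cyclic word at any
  -- point; a cut inside a centre of length ≤ 1 lies at one of its ends.
  conjugate-shape : Center c₁ → Center c₂ → ∀ u A B → cyclic c₁ c₂ u ≡ A ++ B → HasShape u (B ++ A)
  conjugate-shape cc₁ cc₂ u A B eq with ++-equidivisible c₁ (u ++ c₂ ++ reverse u) A B eq
  -- the cut lies in c₁, hence at its start or its end
  ... | inj₂ (x , c₁≡ , refl) with center-split cc₁ A x c₁≡
  ...   | inj₁ refl rewrite c₁≡ = [] , u , refl , inj₁ (solve (++-monoid Step))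
  ...   | inj₂ refl rewrite c₁≡ = [] , u , refl , inj₂ (solve (++-monoid Step))
  -- the cut lies in u
  conjugate-shape cc₁ cc₂ u A B eq | inj₁ (x , refl , rest) with ++-equidivisible u (c₂ ++ reverse u) x B rest
  ... | inj₂ (y , refl , refl) =
        reverse x , y , cong (_++ y) (sym (reverse-involutive x)) , inj₂ (cut-in-u x y)
  -- the cut lies in uʳ
  ... | inj₁ (y , refl , rest′) with ++-equidivisible c₂ (reverse u) y B rest′
  ...   | inj₁ (z , refl , revu≡) =
          B , reverse z , u≡ , inj₁ (trans (cong (λ v → B ++ c₁ ++ v ++ c₂ ++ z) u≡) (cut-in-reverse-u z B))
    where
      u≡ : u ≡ reverse B ++ reverse z
      u≡ = reverse-reverse-factors z B revu≡
  -- the cut lies in c₂, hence at its start or its end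
  ...   | inj₂ (z , c₂≡ , refl) with center-split cc₂ y z c₂≡
  ...     | inj₁ refl rewrite sym c₂≡ =
            reverse u , [] , u≡reverse-reverse-u u , inj₂ (cut-before-c₂ u)
  ...     | inj₂ refl rewrite sym (trans c₂≡ (++-identityʳ y)) =
            reverse u , [] , u≡reverse-reverse-u u , inj₁ (cut-after-c₂ u)

  shape-endpoint : ∀ {u D} → HasShape u D → endpoint D ≡ (endpoint c₁ ⊕ endpoint c₂) ⊕ twice (endpoint u)
  shape-endpoint {u} sh with shape-conjugate sh
  ... | A , B , cyclic≡ , refl =
        trans (endpoint-conjugate A B) (trans (cong endpoint (sym cyclic≡)) (endpoint-cyclic c₁ c₂ u))

-- The centres α, β of the two palindromic factors of a fixed path, one pair
-- for each parity class of (m, n) other than (even, even).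
data CenterPair : Path → Path → Set where
  odd-even : CenterPair [] (E ∷ [])
  even-odd : CenterPair [] (N ∷ [])
  odd-odd  : CenterPair (E ∷ []) (N ∷ [])

module _ {α β : Path} where

  centerˡ : CenterPair α β → Center α
  centerˡ odd-even = none
  centerˡ even-odd = none
  centerˡ odd-odd = single E

  centerʳ : CenterPair α β → Center β
  centerʳ odd-even = single E
  centerʳ even-odd = single N
  centerʳ odd-odd = single N

  centers-distinct : CenterPair α β → α ≢ β
  centers-distinct odd-even ()
  centers-distinct even-odd ()
  centers-distinct odd-odd ()

  centers-by-parity : ∀ {c₁ c₂} → CenterPair α β → Center c₁ → Center c₂ →
                      parity (endpoint c₁ ⊕ endpoint c₂) ≡ parity (endpoint α ⊕ endpoint β) →
                      (c₁ ≡ α × c₂ ≡ β) ⊎ (c₁ ≡ β × c₂ ≡ α)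
  centers-by-parity odd-even none       none       ()
  centers-by-parity odd-even none       (single E) _  = inj₁ (refl , refl)
  centers-by-parity odd-even none       (single N) ()
  centers-by-parity odd-even (single E) none       _  = inj₂ (refl , refl)
  centers-by-parity odd-even (single E) (single E) ()
  centers-by-parity odd-even (single E) (single N) ()
  centers-by-parity odd-even (single N) none       ()
  centers-by-parity odd-even (single N) (single E) ()
  centers-by-parity odd-even (single N) (single N) ()
  centers-by-parity even-odd none       none       ()
  centers-by-parity even-odd none       (single E) ()
  centers-by-parity even-odd none       (single N) _  = inj₁ (refl , refl)
  centers-by-parity even-odd (single E) none       ()
  centers-by-parity even-odd (single E) (single E) ()
  centers-by-parity even-odd (single E) (single N) ()
  centers-by-parity even-odd (single N) none       _  = inj₂ (refl , refl)
  centers-by-parity even-odd (single N) (single E) ()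
  centers-by-parity even-odd (single N) (single N) ()
  centers-by-parity odd-odd  none       none       ()
  centers-by-parity odd-odd  none       (single E) ()
  centers-by-parity odd-odd  none       (single N) ()
  centers-by-parity odd-odd  (single E) none       ()
  centers-by-parity odd-odd  (single E) (single E) ()
  centers-by-parity odd-odd  (single E) (single N) _  = inj₁ (refl , refl)
  centers-by-parity odd-odd  (single N) none       ()
  centers-by-parity odd-odd  (single N) (single E) _  = inj₂ (refl , refl)
  centers-by-parity odd-odd  (single N) (single N) ()

pathsTo : ℕ → ℕ → List Path
pathsTo zero zero = [] ∷ []
pathsTo (suc a) zero = map (E ∷_) (pathsTo a zero)
pathsTo zero (suc b) = map (N ∷_) (pathsTo zero b)
pathsTo (suc a) (suc b) = map (E ∷_) (pathsTo a (suc b)) ++ map (N ∷_) (pathsTo (suc a) b)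

length-pathsTo : ∀ a b → length (pathsTo a b) ≡ (a + b) C a
length-pathsTo zero zero = refl
length-pathsTo (suc a) zero =
  trans (length-map (E ∷_) (pathsTo a zero))
        (trans (length-pathsTo a zero) (trans (diagonal a) (sym (diagonal (suc a)))))
  where
    diagonal : ∀ k → (k + 0) C k ≡ 1
    diagonal k = trans (cong (_C k) (+-identityʳ k)) (nCn≡1 k)
length-pathsTo zero (suc b) = trans (length-map (N ∷_) (pathsTo zero b)) (length-pathsTo zero b)
length-pathsTo (suc a) (suc b) = begin
    length (map (E ∷_) (pathsTo a (suc b)) ++ map (N ∷_) (pathsTo (suc a) b))
      ≡⟨ length-++ (map (E ∷_) (pathsTo a (suc b))) ⟩
    length (map (E ∷_) (pathsTo a (suc b))) + length (map (N ∷_) (pathsTo (suc a) b))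
      ≡⟨ cong₂ _+_ (length-map (E ∷_) (pathsTo a (suc b))) (length-map (N ∷_) (pathsTo (suc a) b)) ⟩
    length (pathsTo a (suc b)) + length (pathsTo (suc a) b)
      ≡⟨ cong₂ _+_ (length-pathsTo a (suc b)) (length-pathsTo (suc a) b) ⟩
    (a + suc b) C a + (suc a + b) C suc a
      ≡⟨ cong (λ k → (a + suc b) C a + k C suc a) (sym (+-suc a b)) ⟩
    (a + suc b) C a + (a + suc b) C suc a
      ≡⟨ nCk+nC[k+1]≡[n+1]C[k+1] (a + suc b) a ⟩
    (suc a + suc b) C suc a ∎
  where open ≡-Reasoning

∈-map-step : ∀ s {xs : List Path} {v u} → (∀ {w} → w ∈ xs → endpoint w ≡ v) →
             u ∈ map (s ∷_) xs → endpoint u ≡ endpoint (s ∷ []) ⊕ v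
∈-map-step s ends u∈ with ∈-map⁻ (s ∷_) u∈
... | w , w∈ , refl = trans (endpoint-++ (s ∷ []) w) (cong (endpoint (s ∷ []) ⊕_) (ends w∈))

pathsTo-sound : ∀ a b {u} → u ∈ pathsTo a b → endpoint u ≡ (a , b)
pathsTo-sound zero zero (here refl) = refl
pathsTo-sound (suc a) zero u∈ = ∈-map-step E (pathsTo-sound a zero) u∈
pathsTo-sound zero (suc b) u∈ = ∈-map-step N (pathsTo-sound zero b) u∈
pathsTo-sound (suc a) (suc b) u∈ with ∈-++⁻ (map (E ∷_) (pathsTo a (suc b))) u∈
... | inj₁ u∈ᴱ = ∈-map-step E (pathsTo-sound a (suc b)) u∈ᴱ
... | inj₂ u∈ᴺ = ∈-map-step N (pathsTo-sound (suc a) b) u∈ᴺ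

pathsTo-complete : ∀ u {a b} → endpoint u ≡ (a , b) → u ∈ pathsTo a b
pathsTo-complete [] refl = here refl
pathsTo-complete (N ∷ u) refl = north (proj₁ (endpoint u)) (proj₂ (endpoint u)) (pathsTo-complete u refl)
  where
    north : ∀ a b {v} → v ∈ pathsTo a b → N ∷ v ∈ pathsTo a (suc b)
    north zero b v∈ = ∈-map⁺ (N ∷_) v∈
    north (suc a) b v∈ = ∈-++⁺ʳ (map (E ∷_) (pathsTo a (suc b))) (∈-map⁺ (N ∷_) v∈)
pathsTo-complete (E ∷ u) refl = east (proj₁ (endpoint u)) (proj₂ (endpoint u)) (pathsTo-complete u refl)
  where
    east : ∀ a b {v} → v ∈ pathsTo a b → E ∷ v ∈ pathsTo (suc a) b
    east a zero v∈ = ∈-map⁺ (E ∷_) v∈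
    east a (suc b) v∈ = ∈-++⁺ˡ (∈-map⁺ (E ∷_) v∈)

pathsTo-unique : ∀ a b → Unique (pathsTo a b)
pathsTo-unique zero zero = All.[] ∷ []
pathsTo-unique (suc a) zero = Unique.map⁺ ∷-injectiveʳ (pathsTo-unique a zero)
pathsTo-unique zero (suc b) = Unique.map⁺ ∷-injectiveʳ (pathsTo-unique zero b)
pathsTo-unique (suc a) (suc b) =
  Unique.++⁺ (Unique.map⁺ ∷-injectiveʳ (pathsTo-unique a (suc b)))
             (Unique.map⁺ ∷-injectiveʳ (pathsTo-unique (suc a) b))
             first-steps-differ
  where
    first-steps-differ : ∀ {v} → v ∈ map (E ∷_) (pathsTo a (suc b)) × v ∈ map (N ∷_) (pathsTo (suc a) b) → ⊥
    first-steps-differ (v∈ᴱ , v∈ᴺ) with ∈-map⁻ (E ∷_) v∈ᴱ | ∈-map⁻ (N ∷_) v∈ᴺ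
    ... | _ , _ , refl | _ , _ , ()

Unique-map-injectiveOn : ∀ {A B : Set} (f : A → B) {xs : List A} → Unique xs →
                         (∀ {x y} → x ∈ xs → y ∈ xs → f x ≡ f y → x ≡ y) → Unique (map f xs)
Unique-map-injectiveOn f {[]} _ _ = []
Unique-map-injectiveOn f {x ∷ xs} (x∉xs ∷ unique) inj =
  All.tabulate fx∉ ∷ Unique-map-injectiveOn f unique (λ x∈ y∈ → inj (there x∈) (there y∈))
  where
    fx∉ : ∀ {z} → z ∈ map f xs → f x ≢ z
    fx∉ z∈ fx≡z with ∈-map⁻ f z∈
    ... | y , y∈ , refl = All.lookup x∉xs y∈ (inj (here refl) (there y∈) fx≡z)

-- Each path u to (a,b) yields the Dyck conjugate of cyclic α β u, and this is a
-- bijection onto the Dyck paths fixed by rank complement.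
module FixedPoints (m n : ℕ) (m>0 : 0 < m) (n>0 : 0 < n) (cop : Coprime m n)
                   {α β : Path} (centers : CenterPair α β) (a b : ℕ)
                   (size : (m , n) ≡ (endpoint α ⊕ endpoint β) ⊕ twice (a , b)) where
  open Rank m n
  open DistinctRanks m n m>0 n>0 cop
  open TwoPalindromes α β

  cα : Center α
  cα = centerˡ centers

  cβ : Center β
  cβ = centerʳ centers

  cyclic-endpoint : ∀ u → endpoint u ≡ (a , b) → endpoint (cyclic α β u) ≡ (m , n)
  cyclic-endpoint u e =
    trans (endpoint-cyclic α β u) (trans (cong (λ v → (endpoint α ⊕ endpoint β) ⊕ twice v) e) (sym size))

  endpoint-of-shape : ∀ {u D} → HasShape u D → endpoint D ≡ (m , n) → endpoint u ≡ (a , b)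
  endpoint-of-shape {u} sh e =
    ⊕-twice-cancel (endpoint α ⊕ endpoint β) (endpoint u) (a , b) (trans (sym (shape-endpoint sh)) (trans e size))

  fixedPathOf : Path → Path
  fixedPathOf u = rotate-to-minimum (cyclic α β u)

  fixedPathOf-dyck : ∀ u → endpoint u ≡ (a , b) → Dyck (fixedPathOf u)
  fixedPathOf-dyck u e = cyclic-lemma (cyclic α β u) (cyclic-endpoint u e)

  fixedPathOf-shape : ∀ u → HasShape u (fixedPathOf u)
  fixedPathOf-shape u = conjugate-shape cα cβ u prefix suffix split
    where open MinimalSplit (minimal-split (cyclic α β u))

  -- A Dyck path has at most one shape: its centred palindromic factors are
  -- unique, and α ≠ β excludes the two shapes of opposite orientation.
  shape-injective : ∀ {u u′ D} → Dyck D → HasShape u D → HasShape u′ D → u ≡ u′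
  shape-injective d (h₁ , h₂ , refl , inj₁ D≡) (h₁′ , h₂′ , refl , inj₁ D≡′)
    with centred-factorisation-unique h₁ h₂ h₁′ h₂′ cα cβ cα cβ d D≡ D≡′
  ... | (refl , _) , (refl , _) = refl
  shape-injective d (h₁ , h₂ , refl , inj₂ D≡) (h₁′ , h₂′ , refl , inj₂ D≡′)
    with centred-factorisation-unique h₂ h₁ h₂′ h₁′ cβ cα cβ cα d D≡ D≡′
  ... | (refl , _) , (refl , _) = refl
  shape-injective d (h₁ , h₂ , _ , inj₁ D≡) (h₁′ , h₂′ , _ , inj₂ D≡′)
    with centred-factorisation-unique h₁ h₂ h₂′ h₁′ cα cβ cβ cα d D≡ D≡′
  ... | (_ , α≡β) , _ = ⊥-elim (centers-distinct centers α≡β)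
  shape-injective d (h₁ , h₂ , _ , inj₂ D≡) (h₁′ , h₂′ , _ , inj₁ D≡′)
    with centred-factorisation-unique h₂ h₁ h₁′ h₂′ cβ cα cα cβ d D≡ D≡′
  ... | (_ , β≡α) , _ = ⊥-elim (centers-distinct centers (sym β≡α))

  -- A product of two palindromes ending at (m,n) has centres α and β, so it has a shape.
  palindromic⇒shape : ∀ {D} h₁ h₂ {c₁ c₂} → Center c₁ → Center c₂ → endpoint D ≡ (m , n) →
                      D ≡ pal h₁ c₁ ++ pal h₂ c₂ → Σ Path λ u → HasShape u D
  palindromic⇒shape {D} h₁ h₂ {c₁} {c₂} cc₁ cc₂ e D≡ with centers-by-parity centers cc₁ cc₂ parities
    where
      open ≡-Reasoning
      parities : parity (endpoint c₁ ⊕ endpoint c₂) ≡ parity (endpoint α ⊕ endpoint β)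
      u₀ : Path
      u₀ = reverse h₁ ++ h₂
      parities = begin
        parity (endpoint c₁ ⊕ endpoint c₂)
          ≡⟨ parity-⊕-twice (endpoint c₁ ⊕ endpoint c₂) (endpoint u₀) ⟨
        parity ((endpoint c₁ ⊕ endpoint c₂) ⊕ twice (endpoint u₀))
          ≡⟨ cong parity (sym (TwoPalindromes.shape-endpoint c₁ c₂ {u₀} (h₁ , h₂ , refl , inj₁ D≡))) ⟩
        parity (endpoint D)
          ≡⟨ cong parity (trans e size) ⟩
        parity ((endpoint α ⊕ endpoint β) ⊕ twice (a , b))
          ≡⟨ parity-⊕-twice (endpoint α ⊕ endpoint β) (a , b) ⟩
        parity (endpoint α ⊕ endpoint β) ∎
  ... | inj₁ (refl , refl) = reverse h₁ ++ h₂ , h₁ , h₂ , refl , inj₁ D≡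
  ... | inj₂ (refl , refl) = reverse h₂ ++ h₁ , h₂ , h₁ , refl , inj₂ D≡

  fixed⇒shape : ∀ {D} → Dyck D → rankComplement m n D ≡ D → Σ Path λ u → HasShape u D
  fixed⇒shape {D} (e , _) fixed with fixed⇒palindromic D fixed
  ... | pal₁ , pal₂ with palindrome-center _ pal₁ | palindrome-center _ pal₂
  ... | h₁ , c₁ , cc₁ , Q₁≡ | h₂ , c₂ , cc₂ , Q₂≡ =
        palindromic⇒shape h₁ h₂ cc₁ cc₂ e
          (trans (sym (take++drop≡id (maxRankIndex m n D) D)) (cong₂ _++_ Q₁≡ Q₂≡))

  fixedPathOf-fixed : ∀ u → endpoint u ≡ (a , b) →
                      IsDyck m n (fixedPathOf u) × rankComplement m n (fixedPathOf u) ≡ fixedPathOf u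
  fixedPathOf-fixed u e with shape-palindromic cα cβ (fixedPathOf-shape u)
  ... | Q₁ , Q₂ , D≡ , pal₁ , pal₂ =
        Equivalence.from (isDyck⇔Dyck (fixedPathOf u)) d ,
        subst (λ P → rankComplement m n P ≡ P) (sym D≡) (palindromic⇒fixed (subst Dyck D≡ d) pal₁ pal₂)
    where
      d : Dyck (fixedPathOf u)
      d = fixedPathOf-dyck u e

  -- A fixed Dyck path of shape u is a Dyck conjugate of cyclic α β u, hence it is fixedPathOf u.
  fixed⇒fixedPathOf : ∀ D → IsDyck m n D → rankComplement m n D ≡ D →
                      Σ Path λ u → endpoint u ≡ (a , b) × D ≡ fixedPathOf u
  fixed⇒fixedPathOf D isDyck fixed with fixed⇒shape (Equivalence.to (isDyck⇔Dyck D) isDyck) fixed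
  ... | u , sh with shape-conjugate sh
  ... | A , B , cyclic≡ , D≡ =
        u , eu , trans D≡ (dyck-conjugates-unique A B prefix suffix (trans (sym cyclic≡) split)
                                                  (subst Dyck D≡ d) (fixedPathOf-dyck u eu))
    where
      open MinimalSplit (minimal-split (cyclic α β u))
      d : Dyck D
      d = Equivalence.to (isDyck⇔Dyck D) isDyck
      eu : endpoint u ≡ (a , b)
      eu = endpoint-of-shape sh (proj₁ d)

  fixed-paths : Σ (List Path) λ L → Unique L ×
                (∀ D → (D ∈ L) ⇔ (IsDyck m n D × rankComplement m n D ≡ D)) × length L ≡ (a + b) C a
  fixed-paths = map fixedPathOf (pathsTo a b) , unique , (λ D → mk⇔ (sound D) (complete D)) ,
                trans (length-map fixedPathOf (pathsTo a b)) (length-pathsTo a b)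
    where
      unique : Unique (map fixedPathOf (pathsTo a b))
      unique = Unique-map-injectiveOn fixedPathOf (pathsTo-unique a b) λ {u} {u′} u∈ _ same →
        shape-injective (fixedPathOf-dyck u (pathsTo-sound a b u∈)) (fixedPathOf-shape u)
                        (subst (HasShape u′) (sym same) (fixedPathOf-shape u′))
      sound : ∀ D → D ∈ map fixedPathOf (pathsTo a b) → IsDyck m n D × rankComplement m n D ≡ D
      sound D D∈ with ∈-map⁻ fixedPathOf D∈
      ... | u , u∈ , refl = fixedPathOf-fixed u (pathsTo-sound a b u∈)
      complete : ∀ D → IsDyck m n D × rankComplement m n D ≡ D → D ∈ map fixedPathOf (pathsTo a b)
      complete D (isDyck , fixed) =
        let u , eu , D≡ = fixed⇒fixedPathOf D isDyck fixed
        in subst (_∈ map fixedPathOf (pathsTo a b)) (sym D≡) (∈-map⁺ fixedPathOf (pathsTo-complete u eu))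

centers-of-parity : ∀ i j → i < 2 → j < 2 → (i ≡ 0 × j ≡ 0 → ⊥) →
                    Σ Path λ α → Σ Path λ β → CenterPair α β × endpoint α ⊕ endpoint β ≡ (i , j)
centers-of-parity 0 0 _ _ not-even = ⊥-elim (not-even (refl , refl))
centers-of-parity 1 0 _ _ _ = [] , E ∷ [] , odd-even , refl
centers-of-parity 0 1 _ _ _ = [] , N ∷ [] , even-odd , refl
centers-of-parity 1 1 _ _ _ = E ∷ [] , N ∷ [] , odd-odd , refl
centers-of-parity (suc (suc _)) _ (s≤s (s≤s ())) _ _
centers-of-parity _ (suc (suc _)) _ (s≤s (s≤s ())) _

theorem2p5 : (m n : ℕ) → 0 < m → 0 < n → Coprime m n →
    Σ (List Path) λ L →
      Unique L ×
      (∀ D → (D ∈ L) ⇔ (IsDyck m n D × rankComplement m n D ≡ D)) ×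
      length L ≡ (m / 2 + n / 2) C (m / 2)
-- Choose the centres from the parities of m and n (not both even, by
-- coprimality) and count in that parity class, with a = m / 2 and b = n / 2.
theorem2p5 m n m>0 n>0 cop with centers-of-parity (m % 2) (n % 2) (m%n<n m 2) (m%n<n n 2) not-both-even
  where
    not-both-even : m % 2 ≡ 0 × n % 2 ≡ 0 → ⊥
    not-both-even (m-even , n-even) with cop (m%n≡0⇒n∣m m 2 m-even , m%n≡0⇒n∣m n 2 n-even)
    ... | ()
... | α , β , centers , parities = FixedPoints.fixed-paths m n m>0 n>0 cop centers (m / 2) (n / 2) size
  where
    size : (m , n) ≡ (endpoint α ⊕ endpoint β) ⊕ twice (m / 2 , n / 2)
    size = trans (cong₂ _,_ (m≡m%n+[m/n]*n m 2) (m≡m%n+[m/n]*n n 2))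
                 (cong (_⊕ twice (m / 2 , n / 2)) (sym parities))
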